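{- For all $n\ge 2$, $\beta(P_{2\infty}\Box P_n)=3$, and $S=\{(0,0),(0,n-1),(1,0)\}$ is a metric basis of $P_{2\infty}\Box P_n$.
   Context: $P_{2\infty}$ has vertex set $\mathbb{Z}$ and $P_n$ has vertex set $\{0,1,\dots,n-1\}$; in each, $i,j$ are adjacent iff $|i-j|=1$. The cartesian product $G\Box H$ has vertex set $V(G)\times V(H)$, with $(a,v)$ adjacent to $(b,w)$ iff either $a=b$ and $vw\in E(H)$, or $v=w$ and $ab\in E(G)$. $d$ is the shortest-path distance. A vertex $x$ resolves $u,v$ if $d(u,x)\neq d(v,x)$; a set $S$ is a resolving set if every pair of distinct vertices is resolved by some vertex of $S$; a metric basis is a resolving set of minimum cardinality and $\beta$ (metric dimension) is its cardinality (infinite if no finite resolving set exists). -}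

module Defs where

open import Level using (0ℓ)
open import Data.Nat as ℕ using (ℕ; zero; suc; _≤_; s≤s; z≤n)
open import Data.Integer as ℤ using (ℤ; +_)
open import Data.Fin using (Fin; toℕ; fromℕ)
open import Data.Product using (_×_; _,_)
open import Data.Sum using (_⊎_)
open import Data.List using (List; []; _∷_; length)
open import Data.List.Relation.Unary.Any using (Any)
open import Data.List.Relation.Unary.Unique.Propositional using (Unique)
open import Relation.Binary.PropositionalEquality using (_≡_; _≢_)
open import Relation.Nullary using (¬_)

record Graph : Set₁ where
  field
    V   : Set
    Adj : V → V → Set
open Graph public

P2∞ : Graph
P2∞ = record { V = ℤ ; Adj = λ i j → ℤ.∣ i ℤ.- j ∣ ≡ 1 }

P : ℕ → Graph
P n = record { V = Fin n ; Adj = λ i j → ℕ.∣ toℕ i - toℕ j ∣ ≡ 1 }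

_□_ : Graph → Graph → Graph
G □ H = record
  { V   = V G × V H
  ; Adj = λ { (a , v) (b , w) → (a ≡ b × Adj H v w) ⊎ (v ≡ w × Adj G a b) } }

data Walk (G : Graph) : V G → V G → ℕ → Set where
  here : ∀ {u} → Walk G u u 0
  step : ∀ {u w v k} → Adj G u w → Walk G w v k → Walk G u v (suc k)

Dist : (G : Graph) → V G → V G → ℕ → Set
Dist G u v k = Walk G u v k × (∀ m → Walk G u v m → k ≤ m)

Resolves : (G : Graph) → V G → V G → V G → Set
Resolves G x u v = ∀ k l → Dist G u x k → Dist G v x l → k ≢ l

Resolving : (G : Graph) → List (V G) → Set
Resolving G S = ∀ u v → u ≢ v → Any (λ x → Resolves G x u v) S

MetricBasis : (G : Graph) → List (V G) → Set
MetricBasis G S =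
  Unique S × Resolving G S ×
  (∀ (T : List (V G)) → Unique T → Resolving G T → length S ≤ length T)

MetricDim : Graph → ℕ → Set
MetricDim G k = Data.Product.∃ λ S → MetricBasis G S × length S ≡ k

Grid : ℕ → Graph
Grid n = P2∞ □ P n

basisS : (n : ℕ) → 2 ≤ n → List (V (Grid n))
basisS (suc (suc m)) (s≤s (s≤s _)) =
  (+ 0 , Fin.zero) ∷ (+ 0 , fromℕ (suc m)) ∷ (+ 1 , Fin.zero) ∷ []
  where import Data.Fin as Fin

-- The argument runs entirely through the explicit L¹ distance
--   gridDist (a , y) (b , z) = |a - b| + |y - z| ,
-- which is shown to be the shortest-path distance of the grid: no walk is shorter
-- (triangle inequality), and walking along the column and then along the row
-- attains it.
--
-- Lower bound: any two landmarks x₁, x₂ leave two distinct vertices unresolved.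
-- Placing the leftmost landmark in column 1 of a frame of natural-number
-- coordinates, the twins lie in columns 0 to 2; which ones depends on whether the
-- landmarks share a column, avoid the bottom row, avoid the top row, or occupy
-- the bottom and top rows.  So every resolving set has at least three vertices.
-- Upper bound: for a vertex (a , y), the distances to (0,0) and (0,n-1) add up to
-- 2|a| + n - 1, so they determine |a| and y; the distance to (1,0) then gives
-- |a - 1|, and |a|, |a - 1| determine a.  Hence S resolves the grid.

module Submission where

open import Defs
open import Data.Nat using (ℕ; _≤_)
open import Data.Product using (_×_)
open import Data.Nat as ℕ using (zero; suc; _+_; _∸_; s≤s; z≤n; ∣_-_∣)
import Data.Nat.Properties as ℕP
open import Data.Nat.Tactic.RingSolver as ℕSolver using ()
open import Data.Integer as ℤ using (ℤ; +_; -[1+_])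
import Data.Integer.Properties as ℤP
open import Data.Integer.Tactic.RingSolver as ℤSolver using ()
open import Data.Fin as Fin using (Fin; toℕ; fromℕ; inject₁)
import Data.Fin.Properties as FinP
open import Data.Product using (Σ; _,_; proj₁; proj₂)
open import Data.Sum using (inj₁; inj₂)
open import Data.List using (List; []; _∷_; length)
open import Data.List.Relation.Unary.Any using (Any; here; there)
open import Data.List.Relation.Unary.All using (All; []; _∷_)
open import Data.List.Relation.Unary.AllPairs using ([]; _∷_)
open import Data.List.Relation.Unary.Unique.Propositional using (Unique)
open import Data.Empty using (⊥-elim)
open import Relation.Nullary using (¬_; yes; no)
open import Relation.Binary.Definitions using (tri<; tri≈; tri>)
open import Relation.Binary.PropositionalEquality

_++ʷ_ : ∀ {G u v w k l} → Walk G u v k → Walk G v w l → Walk G u w (k + l)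
here       ++ʷ q = q
step h p   ++ʷ q = step h (p ++ʷ q)

reverseʷ : ∀ {G} → (∀ {x y} → Adj G x y → Adj G y x) →
           ∀ {u v k} → Walk G u v k → Walk G v u k
reverseʷ adj-sym here = here
reverseʷ {G} adj-sym (step {k = k} h p) =
  subst (Walk G _ _) (ℕP.+-comm k 1) (reverseʷ adj-sym p ++ʷ step (adj-sym h) here)

module ShortestPaths (G : Graph) where

  Dist-unique : ∀ {u v k l} → Dist G u v k → Dist G u v l → k ≡ l
  Dist-unique (walk-k , k-min) (walk-l , l-min) = ℕP.≤-antisym (k-min _ walk-l) (l-min _ walk-k)

  UnresolvedPair : V G → V G → Set
  UnresolvedPair x₁ x₂ = Σ (V G) λ u → Σ (V G) λ v →
    u ≢ v × ¬ Resolves G x₁ u v × ¬ Resolves G x₂ u v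

  unresolved-swap : ∀ {x₁ x₂} → UnresolvedPair x₁ x₂ → UnresolvedPair x₂ x₁
  unresolved-swap (u , v , u≢v , ¬res₁ , ¬res₂) = u , v , u≢v , ¬res₂ , ¬res₁

  three-≤-resolving : V G → (∀ x₁ x₂ → UnresolvedPair x₁ x₂) →
                      ∀ T → Resolving G T → 3 ≤ length T
  three-≤-resolving x unresolved [] resolving
    with unresolved x x
  ... | u , v , u≢v , _ with resolving u v u≢v
  ...   | ()
  three-≤-resolving _ unresolved (x ∷ []) resolving
    with unresolved x x
  ... | u , v , u≢v , ¬res , _ with resolving u v u≢v
  ...   | here res = ⊥-elim (¬res res)
  three-≤-resolving _ unresolved (x₁ ∷ x₂ ∷ []) resolving
    with unresolved x₁ x₂
  ... | u , v , u≢v , ¬res₁ , ¬res₂ with resolving u v u≢v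
  ...   | here res₁         = ⊥-elim (¬res₁ res₁)
  ...   | there (here res₂) = ⊥-elim (¬res₂ res₂)
  three-≤-resolving _ _ (_ ∷ _ ∷ _ ∷ _) _ = s≤s (s≤s (s≤s z≤n))

  module DistanceFunction (d : V G → V G → ℕ) (d-is-dist : ∀ p q → Dist G p q (d p q)) where

    -- d-values are the only possible distances, by uniqueness of Dist.
    resolves-if-≢ : ∀ {x u v} → d u x ≢ d v x → Resolves G x u v
    resolves-if-≢ {x} {u} {v} d≢ k l dist-k dist-l k≡l =
      d≢ (trans (Dist-unique (d-is-dist u x) dist-k) (trans k≡l (Dist-unique dist-l (d-is-dist v x))))

    unresolved-if-≡ : ∀ {x u v} → d u x ≡ d v x → ¬ Resolves G x u v
    unresolved-if-≡ {x} {u} {v} d≡ res = res _ _ (d-is-dist u x) (d-is-dist v x) d≡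

    resolving-if-determined : ∀ {S} → (∀ u v → All (λ x → d u x ≡ d v x) S → u ≡ v) →
                              Resolving G S
    resolving-if-determined determined u v u≢v = find _ (determined u v)
      where
      find : ∀ S → (All (λ x → d u x ≡ d v x) S → u ≡ v) → Any (λ x → Resolves G x u v) S
      find []      same = ⊥-elim (u≢v (same []))
      find (x ∷ S) same with d u x ℕ.≟ d v x
      ... | no  d≢ = here (resolves-if-≢ d≢)
      ... | yes d≡ = there (find S (λ rest → same (d≡ ∷ rest)))

ℤ-triangle : ∀ a b c → ℤ.∣ a ℤ.- c ∣ ≤ ℤ.∣ a ℤ.- b ∣ + ℤ.∣ b ℤ.- c ∣
ℤ-triangle a b c =
  subst (λ i → ℤ.∣ i ∣ ≤ ℤ.∣ a ℤ.- b ∣ + ℤ.∣ b ℤ.- c ∣) (sym (split a b c))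
        (ℤP.∣i+j∣≤∣i∣+∣j∣ (a ℤ.- b) (b ℤ.- c))
  where
  split : ∀ a b c → a ℤ.- c ≡ (a ℤ.- b) ℤ.+ (b ℤ.- c)
  split = ℤSolver.solve-∀

∣i⊖j∣≡∣i-j∣ : ∀ i j → ℤ.∣ i ℤ.⊖ j ∣ ≡ ∣ i - j ∣
∣i⊖j∣≡∣i-j∣ i j with ℕP.≤-total i j
... | inj₁ i≤j = trans (ℤP.∣⊖∣-≤ i≤j) (sym (ℕP.m≤n⇒∣m-n∣≡n∸m i≤j))
... | inj₂ j≤i = trans (ℤP.∣m⊖n∣≡∣n⊖m∣ i j)
                   (trans (ℤP.∣⊖∣-≤ j≤i) (sym (trans (ℕP.∣-∣-comm i j) (ℕP.m≤n⇒∣m-n∣≡n∸m j≤i))))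

∣1+m-y∣≡1+∣m-y∣ : ∀ {m y} → y ≤ m → ∣ suc m - y ∣ ≡ suc ∣ m - y ∣
∣1+m-y∣≡1+∣m-y∣ {m} {y} y≤m = begin
  ∣ suc m - y ∣ ≡⟨ ℕP.∣-∣-comm (suc m) y ⟩
  ∣ y - suc m ∣ ≡⟨ ℕP.m≤n⇒∣m-n∣≡n∸m (ℕP.m≤n⇒m≤1+n y≤m) ⟩
  suc m ∸ y     ≡⟨ ℕP.+-∸-assoc 1 y≤m ⟩
  suc (m ∸ y)   ≡⟨ cong suc (trans (ℕP.∣-∣-comm m y) (ℕP.m≤n⇒∣m-n∣≡n∸m y≤m)) ⟨
  suc ∣ m - y ∣ ∎
  where open ≡-Reasoning

-- A non-negative p and a negative integer with the same absolute value suc q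
-- differ in their distance to 1: it is q for p and q + 2 for the other.
opposite-signs : ∀ p q → ℤ.∣ + p ∣ ≡ ℤ.∣ -[1+ q ] ∣ →
                 ℤ.∣ + p ℤ.- + 1 ∣ ≢ ℤ.∣ -[1+ q ] ℤ.- + 1 ∣
opposite-signs _ q refl q≡q+2 = ℕP.m≢1+m+n q (trans q≡q+2 (cong suc (sym (ℕP.+-suc q 0))))

ℤ-determined : ∀ a b → ℤ.∣ a ∣ ≡ ℤ.∣ b ∣ →
               ℤ.∣ a ℤ.- + 1 ∣ ≡ ℤ.∣ b ℤ.- + 1 ∣ → a ≡ b
ℤ-determined (+ p)    (+ q)    ∣a∣≡∣b∣ _ = cong +_ ∣a∣≡∣b∣
ℤ-determined -[1+ p ] -[1+ q ] ∣a∣≡∣b∣ _ = cong -[1+_] (ℕP.suc-injective ∣a∣≡∣b∣)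
ℤ-determined (+ p)    -[1+ q ] ∣a∣≡∣b∣ ∣a-1∣≡∣b-1∣ =
  ⊥-elim (opposite-signs p q ∣a∣≡∣b∣ ∣a-1∣≡∣b-1∣)
ℤ-determined -[1+ p ] (+ q)    ∣a∣≡∣b∣ ∣a-1∣≡∣b-1∣ =
  ⊥-elim (opposite-signs q p (sym ∣a∣≡∣b∣) (sym ∣a-1∣≡∣b-1∣))

double-injective : ∀ {A B} → A + A ≡ B + B → A ≡ B
double-injective {A} {B} A+A≡B+B with ℕP.<-cmp A B
... | tri< A<B _ _ = ⊥-elim (ℕP.<⇒≢ (ℕP.+-mono-< A<B A<B) A+A≡B+B)
... | tri≈ _ A≡B _ = A≡B
... | tri> _ _ B<A = ⊥-elim (ℕP.<⇒≢ (ℕP.+-mono-< B<A B<A) (sym A+A≡B+B))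

sum-to-segment-ends : ∀ A Y M → Y ≤ M → (A + Y) + (A + ∣ Y - M ∣) ≡ (A + A) + M
sum-to-segment-ends A Y M Y≤M = begin
  (A + Y) + (A + ∣ Y - M ∣) ≡⟨ interchange A Y A ∣ Y - M ∣ ⟩
  (A + A) + (Y + ∣ Y - M ∣) ≡⟨ cong (λ r → (A + A) + (Y + r)) (ℕP.m≤n⇒∣m-n∣≡n∸m Y≤M) ⟩
  (A + A) + (Y + (M ∸ Y))   ≡⟨ cong (λ r → (A + A) + r) (ℕP.m+[n∸m]≡n Y≤M) ⟩
  (A + A) + M               ∎
  where
  open ≡-Reasoning
  interchange : ∀ p q r s → (p + q) + (r + s) ≡ (p + r) + (q + s)
  interchange = ℕSolver.solve-∀

segment-determined : ∀ {A B Y Z M} → Y ≤ M → Z ≤ M →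
                     A + Y ≡ B + Z → A + ∣ Y - M ∣ ≡ B + ∣ Z - M ∣ → A ≡ B × Y ≡ Z
segment-determined {A} {B} {Y} {Z} {M} Y≤M Z≤M to-bottom to-top =
  A≡B , ℕP.+-cancelˡ-≡ A Y Z (trans to-bottom (cong (_+ Z) (sym A≡B)))
  where
  A≡B : A ≡ B
  A≡B = double-injective (ℕP.+-cancelʳ-≡ M (A + A) (B + B) (begin
    (A + A) + M               ≡⟨ sum-to-segment-ends A Y M Y≤M ⟨
    (A + Y) + (A + ∣ Y - M ∣) ≡⟨ cong₂ _+_ to-bottom to-top ⟩
    (B + Z) + (B + ∣ Z - M ∣) ≡⟨ sum-to-segment-ends B Z M Z≤M ⟩
    (B + B) + M               ∎))
    where open ≡-Reasoning

∣n-1+n∣≡1 : ∀ n → ∣ n - suc n ∣ ≡ 1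
∣n-1+n∣≡1 zero    = refl
∣n-1+n∣≡1 (suc n) = ∣n-1+n∣≡1 n

gridDist : ∀ {n} → V (Grid n) → V (Grid n) → ℕ
gridDist (a , y) (b , z) = ℤ.∣ a ℤ.- b ∣ + ∣ toℕ y - toℕ z ∣

gridDist-triangle : ∀ {n} (p q r : V (Grid n)) → gridDist p r ≤ gridDist p q + gridDist q r
gridDist-triangle (a , y) (b , z) (c , w) = begin
  ℤ.∣ a ℤ.- c ∣ + ∣ toℕ y - toℕ w ∣
    ≤⟨ ℕP.+-mono-≤ (ℤ-triangle a b c) (ℕP.∣-∣-triangle (toℕ y) (toℕ z) (toℕ w)) ⟩
  (ℤ.∣ a ℤ.- b ∣ + ℤ.∣ b ℤ.- c ∣) + (∣ toℕ y - toℕ z ∣ + ∣ toℕ z - toℕ w ∣)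
    ≡⟨ interchange (ℤ.∣ a ℤ.- b ∣) (ℤ.∣ b ℤ.- c ∣) (∣ toℕ y - toℕ z ∣) (∣ toℕ z - toℕ w ∣) ⟩
  (ℤ.∣ a ℤ.- b ∣ + ∣ toℕ y - toℕ z ∣) + (ℤ.∣ b ℤ.- c ∣ + ∣ toℕ z - toℕ w ∣) ∎
  where
  open ℕP.≤-Reasoning
  interchange : ∀ p q r s → (p + q) + (r + s) ≡ (p + r) + (q + s)
  interchange = ℕSolver.solve-∀

ℤ-∣a-a∣ : ∀ a → ℤ.∣ a ℤ.- a ∣ ≡ 0
ℤ-∣a-a∣ a = cong ℤ.∣_∣ (ℤP.+-inverseʳ a)

gridDist-self : ∀ {n} (p : V (Grid n)) → gridDist p p ≡ 0
gridDist-self (a , y) = cong₂ _+_ (ℤ-∣a-a∣ a) (ℕP.∣n-n∣≡0 (toℕ y))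

gridDist-adjacent : ∀ {n} {p q : V (Grid n)} → Adj (Grid n) p q → gridDist p q ≡ 1
gridDist-adjacent {p = a , _} (inj₁ (refl , y~z)) = cong₂ _+_ (ℤ-∣a-a∣ a) y~z
gridDist-adjacent {p = _ , y} (inj₂ (refl , a~b)) = cong₂ _+_ a~b (ℕP.∣n-n∣≡0 (toℕ y))

-- Each step of a walk changes the L¹ distance to the endpoint by at most one,
-- so no walk is shorter than gridDist.
gridDist-≤-walk : ∀ {n} {p q : V (Grid n)} {k} → Walk (Grid n) p q k → gridDist p q ≤ k
gridDist-≤-walk {p = p} here = ℕP.≤-reflexive (gridDist-self p)
gridDist-≤-walk {p = p} {q} (step {w = r} {k = k} p~r walk) = begin
  gridDist p q               ≤⟨ gridDist-triangle p r q ⟩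
  gridDist p r + gridDist r q ≡⟨ cong (_+ gridDist r q) (gridDist-adjacent p~r) ⟩
  suc (gridDist r q)          ≤⟨ s≤s (gridDist-≤-walk walk) ⟩
  suc k                       ∎
  where open ℕP.≤-Reasoning

P2∞-adj-sym : ∀ {a b} → Adj P2∞ a b → Adj P2∞ b a
P2∞-adj-sym {a} {b} a~b = trans (ℤP.∣i-j∣≡∣j-i∣ b a) a~b

P-adj-sym : ∀ {n} {y z : Fin n} → Adj (P n) y z → Adj (P n) z y
P-adj-sym {y = y} {z} y~z = trans (ℕP.∣-∣-comm (toℕ z) (toℕ y)) y~z

walk-right : ∀ a k → Walk P2∞ a (a ℤ.+ + k) k
walk-right a zero    = subst (λ b → Walk P2∞ a b 0) (sym (ℤP.+-identityʳ a)) here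
walk-right a (suc k) =
  step a~a+1 (subst (λ b → Walk P2∞ (a ℤ.+ + 1) b k) (ℤP.+-assoc a (+ 1) (+ k))
                    (walk-right (a ℤ.+ + 1) k))
  where
  a~a+1 : Adj P2∞ a (a ℤ.+ + 1)
  a~a+1 = cong ℤ.∣_∣ (neighbour a)
    where
    neighbour : ∀ a → a ℤ.- (a ℤ.+ + 1) ≡ ℤ.- (+ 1)
    neighbour = ℤSolver.solve-∀

walk-up-to : ∀ {a b} → a ℤ.≤ b → Walk P2∞ a b ℤ.∣ a ℤ.- b ∣
walk-up-to {a} {b} a≤b =
  subst (λ c → Walk P2∞ a c ℤ.∣ a ℤ.- b ∣) a+[b-a]≡b (walk-right a ℤ.∣ a ℤ.- b ∣)
  where
  cancel : ∀ a b → a ℤ.+ (b ℤ.- a) ≡ b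
  cancel = ℤSolver.solve-∀
  a+[b-a]≡b : a ℤ.+ + ℤ.∣ a ℤ.- b ∣ ≡ b
  a+[b-a]≡b = trans (cong (λ i → a ℤ.+ i) (ℤP.∣-∣-≤ a≤b)) (cancel a b)

column-walk : ∀ a b → Walk P2∞ a b ℤ.∣ a ℤ.- b ∣
column-walk a b with ℤP.≤-total a b
... | inj₁ a≤b = walk-up-to a≤b
... | inj₂ b≤a = subst (Walk P2∞ a b) (ℤP.∣i-j∣≡∣j-i∣ b a)
                   (reverseʷ (λ {a} {b} → P2∞-adj-sym {a} {b}) (walk-up-to b≤a))

shift-up : ∀ {n} {y z : Fin n} {k} → Walk (P n) y z k → Walk (P (suc n)) (Fin.suc y) (Fin.suc z) k
shift-up here         = here
shift-up (step y~w w) = step y~w (shift-up w)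

row-walk-up : ∀ {n} (y z : Fin n) → toℕ y ≤ toℕ z → Walk (P n) y z (toℕ z ∸ toℕ y)
row-walk-up               Fin.zero    Fin.zero    _         = here
row-walk-up {suc (suc _)} Fin.zero    (Fin.suc z) _         = step refl (shift-up (row-walk-up Fin.zero z z≤n))
row-walk-up               (Fin.suc y) (Fin.suc z) (s≤s y≤z) = shift-up (row-walk-up y z y≤z)

row-walk : ∀ {n} (y z : Fin n) → Walk (P n) y z ∣ toℕ y - toℕ z ∣
row-walk y z with ℕP.≤-total (toℕ y) (toℕ z)
... | inj₁ y≤z = subst (Walk _ y z) (sym (ℕP.m≤n⇒∣m-n∣≡n∸m y≤z)) (row-walk-up y z y≤z)
... | inj₂ z≤y = subst (Walk _ y z) (sym (trans (ℕP.∣-∣-comm (toℕ y) (toℕ z)) (ℕP.m≤n⇒∣m-n∣≡n∸m z≤y)))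
                   (reverseʷ (λ {y} {z} → P-adj-sym {y = y} {z}) (row-walk-up z y z≤y))

grid-walk : ∀ {n} (p q : V (Grid n)) → Walk (Grid n) p q (gridDist p q)
grid-walk (a , y) (b , z) = along-column (column-walk a b) ++ʷ along-row (row-walk y z)
  where
  along-column : ∀ {a b k} → Walk P2∞ a b k → Walk (Grid _) (a , y) (b , y) k
  along-column here         = here
  along-column (step a~c w) = step (inj₂ (refl , a~c)) (along-column w)
  along-row : ∀ {y z k} → Walk (P _) y z k → Walk (Grid _) (b , y) (b , z) k
  along-row here         = here
  along-row (step y~w w) = step (inj₁ (refl , y~w)) (along-row w)

gridDist-isDist : ∀ {n} (p q : V (Grid n)) → Dist (Grid n) p q (gridDist p q)
gridDist-isDist p q = grid-walk p q , λ _ walk → gridDist-≤-walk walk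

module GridDistance {n : ℕ} = ShortestPaths.DistanceFunction (Grid n) gridDist gridDist-isDist

-- Points addressed relative to a base column c: the frame point (i , y) is the
-- vertex (c + i , y).  Frame distances only involve natural numbers.
Frame : ℕ → Set
Frame n = ℕ × Fin n

frameDist : ∀ {n} → Frame n → Frame n → ℕ
frameDist (i , y) (j , z) = ∣ i - j ∣ + ∣ toℕ y - toℕ z ∣

at : ∀ {n} → ℤ → Frame n → V (Grid n)
at c (i , y) = (c ℤ.+ + i , y)

-- The grid distance is translation invariant, so it equals the frame distance.
gridDist-at : ∀ {n} c (p q : Frame n) → gridDist (at c p) (at c q) ≡ frameDist p q
gridDist-at c (i , y) (j , z) = cong (_+ ∣ toℕ y - toℕ z ∣) (begin
  ℤ.∣ (c ℤ.+ + i) ℤ.- (c ℤ.+ + j) ∣ ≡⟨ cong ℤ.∣_∣ (translate c (+ i) (+ j)) ⟩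
  ℤ.∣ + i ℤ.- + j ∣                 ≡⟨ cong ℤ.∣_∣ (ℤP.[+m]-[+n]≡m⊖n i j) ⟩
  ℤ.∣ i ℤ.⊖ j ∣                     ≡⟨ ∣i⊖j∣≡∣i-j∣ i j ⟩
  ∣ i - j ∣                         ∎)
  where
  open ≡-Reasoning
  translate : ∀ c i j → (c ℤ.+ i) ℤ.- (c ℤ.+ j) ≡ i ℤ.- j
  translate = ℤSolver.solve-∀

FrameTwins : ∀ {n} → Frame n → Frame n → Set
FrameTwins {n} x₁ x₂ = Σ (Frame n) λ u → Σ (Frame n) λ v →
  proj₁ u ≢ proj₁ v × frameDist u x₁ ≡ frameDist v x₁ × frameDist u x₂ ≡ frameDist v x₂

frame-twins-unresolved : ∀ {n} c {x₁ x₂ : Frame n} → FrameTwins x₁ x₂ →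
                         ShortestPaths.UnresolvedPair (Grid n) (at c x₁) (at c x₂)
frame-twins-unresolved c {x₁} {x₂} (u , v , columns≢ , same₁ , same₂) =
  at c u , at c v , distinct ,
  GridDistance.unresolved-if-≡ (via-frame x₁ same₁) ,
  GridDistance.unresolved-if-≡ (via-frame x₂ same₂)
  where
  via-frame : ∀ x → frameDist u x ≡ frameDist v x →
              gridDist (at c u) (at c x) ≡ gridDist (at c v) (at c x)
  via-frame x same = trans (gridDist-at c u x) (trans same (sym (gridDist-at c v x)))
  distinct : at c u ≢ at c v
  distinct u≡v = columns≢ (ℕP.∣m-n∣≡0⇒m≡n (ℕP.m+n≡0⇒m≡0 _ frameDist≡0))
    where
    frameDist≡0 : frameDist u v ≡ 0
    frameDist≡0 = begin
      frameDist u v              ≡⟨ gridDist-at c u v ⟨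
      gridDist (at c u) (at c v) ≡⟨ cong (λ w → gridDist w (at c v)) u≡v ⟩
      gridDist (at c v) (at c v) ≡⟨ gridDist-self (at c v) ⟩
      0                          ∎
      where open ≡-Reasoning

module GridOfHeight (m : ℕ) where

  Row : Set
  Row = Fin (suc (suc m))

  bottom second below-top top : Row
  bottom    = Fin.zero
  second    = Fin.suc Fin.zero
  below-top = inject₁ (fromℕ m)
  top       = fromℕ (suc m)

  toℕ-below-top : toℕ below-top ≡ m
  toℕ-below-top = trans (FinP.toℕ-inject₁ (fromℕ m)) (FinP.toℕ-fromℕ m)

  -- Moving from (0, second) to (1, bottom) brings us one column closer to a
  -- landmark in column t+1 and one row farther from it, if it is not in the bottom row.
  equidistant-below : ∀ t (b : Row) → 1 ≤ toℕ b →
                      frameDist (0 , second) (suc t , b) ≡ frameDist (1 , bottom) (suc t , b)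
  equidistant-below t b 1≤b with toℕ b | 1≤b
  ... | suc y | s≤s z≤n = sym (ℕP.+-suc t y)

  -- Mirror image: moving from (0, below-top) to (1, top), for a landmark not in the top row.
  equidistant-above : ∀ t (b : Row) → toℕ b ≤ m →
                      frameDist (0 , below-top) (suc t , b) ≡ frameDist (1 , top) (suc t , b)
  equidistant-above t b b≤m = begin
    suc t + ∣ toℕ below-top - toℕ b ∣ ≡⟨ cong (λ r → suc t + ∣ r - toℕ b ∣) toℕ-below-top ⟩
    suc t + ∣ m - toℕ b ∣             ≡⟨ ℕP.+-suc t _ ⟨
    t + suc ∣ m - toℕ b ∣             ≡⟨ cong (λ r → t + r) (∣1+m-y∣≡1+∣m-y∣ b≤m) ⟨
    t + ∣ suc m - toℕ b ∣             ≡⟨ cong (λ r → t + ∣ r - toℕ b ∣) (FinP.toℕ-fromℕ (suc m)) ⟨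
    t + ∣ toℕ top - toℕ b ∣           ∎
    where open ≡-Reasoning

  -- Both in column 1: reflect across that column.
  same-column : ∀ (b₁ b₂ : Row) → FrameTwins (1 , b₁) (1 , b₂)
  same-column _ _ = (0 , bottom) , (2 , bottom) , (λ ()) , refl , refl

  both-above-bottom : ∀ t (b₁ b₂ : Row) → 1 ≤ toℕ b₁ → 1 ≤ toℕ b₂ →
                      FrameTwins (1 , b₁) (suc t , b₂)
  both-above-bottom t b₁ b₂ 1≤b₁ 1≤b₂ =
    (0 , second) , (1 , bottom) , (λ ()) , equidistant-below 0 b₁ 1≤b₁ , equidistant-below t b₂ 1≤b₂

  both-below-top : ∀ t (b₁ b₂ : Row) → toℕ b₁ ≤ m → toℕ b₂ ≤ m →
                   FrameTwins (1 , b₁) (suc t , b₂)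
  both-below-top t b₁ b₂ b₁≤m b₂≤m =
    (0 , below-top) , (1 , top) , (λ ()) , equidistant-above 0 b₁ b₁≤m , equidistant-above t b₂ b₂≤m

  -- x₁ at the bottom, x₂ strictly to its right and not at the bottom: both
  -- neighbours (1, second) and (2, bottom) of x₁ are equally far from x₂.
  bottom-then-right : ∀ s (b₁ b₂ : Row) → toℕ b₁ ≡ 0 → 1 ≤ toℕ b₂ →
                      FrameTwins (1 , b₁) (suc (suc s) , b₂)
  bottom-then-right s b₁ b₂ b₁≡0 1≤b₂ =
    (1 , second) , (2 , bottom) , (λ ()) , neighbours-of-x₁ , equidistant-below s b₂ 1≤b₂
    where
    neighbours-of-x₁ : ∣ 1 - toℕ b₁ ∣ ≡ suc (toℕ b₁)
    neighbours-of-x₁ rewrite b₁≡0 = refl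

  top-then-right : ∀ s (b₁ b₂ : Row) → toℕ b₁ ≡ suc m → toℕ b₂ ≤ m →
                   FrameTwins (1 , b₁) (suc (suc s) , b₂)
  top-then-right s b₁ b₂ b₁≡top b₂≤m =
    (1 , below-top) , (2 , top) , (λ ()) , neighbours-of-x₁ , equidistant-above s b₂ b₂≤m
    where
    neighbours-of-x₁ : ∣ toℕ below-top - toℕ b₁ ∣ ≡ suc ∣ toℕ top - toℕ b₁ ∣
    neighbours-of-x₁ rewrite toℕ-below-top | FinP.toℕ-fromℕ (suc m) | b₁≡top =
      trans (∣n-1+n∣≡1 m) (cong suc (sym (ℕP.∣n-n∣≡0 m)))

  at-top : ∀ (b : Row) → ¬ toℕ b ≤ m → toℕ b ≡ suc m
  at-top b b≰m = ℕP.≤-antisym (FinP.toℕ≤pred[n] b) (ℕP.≰⇒> b≰m)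

  above-bottom : ∀ {y} → ¬ y ≤ m → 1 ≤ y
  above-bottom y≰m = ℕP.≤-trans (s≤s z≤n) (ℕP.≰⇒> y≰m)

  frame-twins : ∀ t (b₁ b₂ : Row) → FrameTwins (1 , b₁) (suc t , b₂)
  frame-twins zero    b₁ b₂ = same-column b₁ b₂
  frame-twins (suc s) b₁ b₂ with toℕ b₁ ℕ.≤? m | toℕ b₂ ℕ.≤? m
  ... | yes b₁≤m | yes b₂≤m = both-below-top (suc s) b₁ b₂ b₁≤m b₂≤m
  ... | no  b₁≰m | _ with toℕ b₂ ℕ.≟ 0
  ...   | yes b₂≡0 = top-then-right s b₁ b₂ (at-top b₁ b₁≰m) (subst (_≤ m) (sym b₂≡0) z≤n)
  ...   | no  b₂≢0 = both-above-bottom (suc s) b₁ b₂ (above-bottom b₁≰m) (ℕP.n≢0⇒n>0 b₂≢0)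
  frame-twins (suc s) b₁ b₂ | yes _ | no b₂≰m with toℕ b₁ ℕ.≟ 0
  ...   | yes b₁≡0 = bottom-then-right s b₁ b₂ b₁≡0 (above-bottom b₂≰m)
  ...   | no  b₁≢0 = both-above-bottom (suc s) b₁ b₂ (ℕP.n≢0⇒n>0 b₁≢0) (above-bottom b₂≰m)

  open ShortestPaths (Grid (suc (suc m))) using (UnresolvedPair; unresolved-swap; three-≤-resolving)

  -- Landmarks with x₁ weakly left of x₂ leave a pair unresolved: in the frame
  -- based at column a₁ - 1, x₁ sits in column 1 and x₂ in column |a₁ - a₂| + 1.
  unresolved-left-right : ∀ {a₁ a₂} (b₁ b₂ : Row) → a₁ ℤ.≤ a₂ →
                          UnresolvedPair (a₁ , b₁) (a₂ , b₂)
  unresolved-left-right {a₁} {a₂} b₁ b₂ a₁≤a₂ =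
    subst₂ (λ c₁ c₂ → UnresolvedPair (c₁ , b₁) (c₂ , b₂)) (x₁-column a₁) x₂-column
      (frame-twins-unresolved (a₁ ℤ.- + 1) (frame-twins ℤ.∣ a₁ ℤ.- a₂ ∣ b₁ b₂))
    where
    x₁-column : ∀ a → (a ℤ.- + 1) ℤ.+ + 1 ≡ a
    x₁-column = ℤSolver.solve-∀
    shifted : ∀ a₁ a₂ → (a₁ ℤ.- + 1) ℤ.+ (+ 1 ℤ.+ (a₂ ℤ.- a₁)) ≡ a₂
    shifted = ℤSolver.solve-∀
    x₂-column : (a₁ ℤ.- + 1) ℤ.+ + suc ℤ.∣ a₁ ℤ.- a₂ ∣ ≡ a₂
    x₂-column = trans (cong (λ i → (a₁ ℤ.- + 1) ℤ.+ (+ 1 ℤ.+ i)) (ℤP.∣-∣-≤ a₁≤a₂)) (shifted a₁ a₂)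

  any-two-unresolved : ∀ x₁ x₂ → UnresolvedPair x₁ x₂
  any-two-unresolved (a₁ , b₁) (a₂ , b₂) with ℤP.≤-total a₁ a₂
  ... | inj₁ a₁≤a₂ = unresolved-left-right b₁ b₂ a₁≤a₂
  ... | inj₂ a₂≤a₁ = unresolved-swap (unresolved-left-right b₂ b₁ a₂≤a₁)

  resolving-has-three : ∀ T → Resolving (Grid (suc (suc m))) T → 3 ≤ length T
  resolving-has-three = three-≤-resolving (+ 0 , bottom) any-two-unresolved

  S : List (V (Grid (suc (suc m))))
  S = basisS (suc (suc m)) (s≤s (s≤s z≤n))

  -- Upper bound: the distances to (0,0) and (0,m+1) determine |a| and the row y
  -- of a vertex (a , y); together with the distance to (1,0) they determine a.
  S-determines : ∀ u v → All (λ x → gridDist u x ≡ gridDist v x) S → u ≡ v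
  S-determines (a , y) (b , z) (to-origin ∷ to-top ∷ to-right ∷ []) =
    cong₂ _,_ (ℤ-determined a b ∣a∣≡∣b∣ ∣a-1∣≡∣b-1∣) (FinP.toℕ-injective y≡z)
    where
    open ≡-Reasoning
    from-bottom-row : ∀ c d (r : Row) → gridDist (c , r) (d , bottom) ≡ ℤ.∣ c ℤ.- d ∣ + toℕ r
    from-bottom-row c d r = cong (λ k → ℤ.∣ c ℤ.- d ∣ + k) (ℕP.∣-∣-identityʳ (toℕ r))
    ∣c-0∣≡∣c∣ : ∀ c → ℤ.∣ c ℤ.- + 0 ∣ ≡ ℤ.∣ c ∣
    ∣c-0∣≡∣c∣ c = cong ℤ.∣_∣ (ℤP.+-identityʳ c)
    from-origin : ∀ c (r : Row) → gridDist (c , r) (+ 0 , bottom) ≡ ℤ.∣ c ∣ + toℕ r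
    from-origin c r = trans (from-bottom-row c (+ 0) r) (cong (_+ toℕ r) (∣c-0∣≡∣c∣ c))
    from-top : ∀ c (r : Row) → gridDist (c , r) (+ 0 , top) ≡ ℤ.∣ c ∣ + ∣ toℕ r - suc m ∣
    from-top c r = cong₂ _+_ (∣c-0∣≡∣c∣ c) (cong (λ k → ∣ toℕ r - k ∣) (FinP.toℕ-fromℕ (suc m)))
    segment : ℤ.∣ a ∣ ≡ ℤ.∣ b ∣ × toℕ y ≡ toℕ z
    segment = segment-determined (FinP.toℕ≤pred[n] y) (FinP.toℕ≤pred[n] z)
      (trans (sym (from-origin a y)) (trans to-origin (from-origin b z)))
      (trans (sym (from-top a y)) (trans to-top (from-top b z)))
    ∣a∣≡∣b∣ : ℤ.∣ a ∣ ≡ ℤ.∣ b ∣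
    ∣a∣≡∣b∣ = proj₁ segment
    y≡z : toℕ y ≡ toℕ z
    y≡z = proj₂ segment
    ∣a-1∣≡∣b-1∣ : ℤ.∣ a ℤ.- + 1 ∣ ≡ ℤ.∣ b ℤ.- + 1 ∣
    ∣a-1∣≡∣b-1∣ = ℕP.+-cancelʳ-≡ (toℕ y) _ _ (begin
      ℤ.∣ a ℤ.- + 1 ∣ + toℕ y         ≡⟨ from-bottom-row a (+ 1) y ⟨
      gridDist (a , y) (+ 1 , bottom) ≡⟨ to-right ⟩
      gridDist (b , z) (+ 1 , bottom) ≡⟨ from-bottom-row b (+ 1) z ⟩
      ℤ.∣ b ℤ.- + 1 ∣ + toℕ z         ≡⟨ cong (λ k → ℤ.∣ b ℤ.- + 1 ∣ + k) y≡z ⟨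
      ℤ.∣ b ℤ.- + 1 ∣ + toℕ y         ∎)

  S-resolving : Resolving (Grid (suc (suc m))) S
  S-resolving = GridDistance.resolving-if-determined S-determines

  S-metric-basis : MetricBasis (Grid (suc (suc m))) S
  S-metric-basis = S-distinct , S-resolving , λ T _ → resolving-has-three T
    where
    S-distinct : Unique S
    S-distinct = ((λ ()) ∷ (λ ()) ∷ []) ∷ ((λ ()) ∷ []) ∷ [] ∷ []

proposition5 : (n : ℕ) → (h : 2 ≤ n) →
    MetricDim (Grid n) 3 × MetricBasis (Grid n) (basisS n h)
proposition5 (suc (suc m)) (s≤s (s≤s z≤n)) = (S , S-metric-basis , refl) , S-metric-basis
  where open GridOfHeight m
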